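{- Let $(\mathfrak{M},s)$ and $(\mathfrak{M}',s')$ be pointed pre-models and $G$ a group. If $(\mathfrak{M},s)$ and $(\mathfrak{M}',s')$ are bisimilar, then $(\mathfrak{M}|_G,s)$ and $(\mathfrak{M}'|_G,s')$ are bisimilar.
   Context: Fix a finite set $\textsc{ag}$ of agents and a set $\textsc{prop}$ of propositional variables; $\textsc{gr}$ is the set of nonempty subsets of $\textsc{ag}$. A pre-model is $\mathfrak{M}=(S,\backsim,V)$ where $S$ is a nonempty set, $\backsim$ assigns to every agent $i$ an equivalence relation $\backsim_i$ and to every group $G\in\textsc{gr}$ an equivalence relation $\backsim_G$ on $S$ (primitive), and $V:\textsc{prop}\to\wp(S)$. For a group $G$, $\mathfrak{M}|_G=(S,\backsim|_G,V)$ where $(\backsim|_G)_i=\backsim_G$ if $i\in G$ and $\backsim_i$ otherwise, and $(\backsim|_G)_H=\backsim_{H\cup G}$ if $H\cap G\neq\emptyset$ and $\backsim_H$ otherwise. A bisimulation between pre-models $\mathfrak{M}=(S,\backsim,V)$ and $\mathfrak{M}'=(S',\backsim',V')$ is a nonempty $Z\subseteq S\times S'$ such that whenever $sZs'$: $s\in V(p)$ iff $s'\in V'(p)$ for all $p$; for every $\tau\in\textsc{ag}\cup\textsc{gr}$ and $t$ with $s\backsim_\tau t$ there is $t'$ with $s'\backsim'_\tau t'$ and $tZt'$; and for every $\tau$ and $t'$ with $s'\backsim'_\tau t'$ there is $t$ with $s\backsim_\tau t$ and $tZt'$. Pointed pre-models $(\mathfrak{M},s),(\mathfrak{M}',s')$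 are bisimilar if some bisimulation links $s$ and $s'$. -}

module Defs where

open import Level using (Level; _⊔_) renaming (suc to lsuc)
open import Data.Nat using (ℕ)
open import Data.Fin using (Fin)
open import Data.Fin.Subset using (Subset; _∈_; _∪_; _∩_; Nonempty)
open import Data.Fin.Subset.Properties using (nonempty?; p⊆p∪q; _∈?_)
open import Data.Product using (Σ; _×_; _,_; ∃; proj₁; proj₂)
open import Relation.Nullary using (¬_; yes; no)
open import Relation.Nullary.Decidable using (True; fromWitness; toWitness)
open import Relation.Binary using (Rel; IsEquivalence)

-- The nonemptiness witness is
-- 'True (nonempty? H)', a proof-irrelevant (⊤ or ⊥) type, so a group is
-- determined by its underlying subset.
record Group (n : ℕ) : Set where
  constructor group
  field
    members  : Subset n
    nonempty : True (nonempty? members)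
open Group public

_∪ᴳ_ : {n : ℕ} → Group n → Group n → Group n
H ∪ᴳ G = group (members H ∪ members G) (fromWitness ne)
  where
  ne : Nonempty (members H ∪ members G)
  ne with toWitness (nonempty H)
  ... | i , i∈H = i , p⊆p∪q (members G) i∈H

data Index (n : ℕ) : Set where
  agent : Fin n → Index n
  grp   : Group n → Index n

record PreModel (n : ℕ) {p : Level} (Prop : Set p) (a ℓ : Level)
       : Set (p ⊔ lsuc a ⊔ lsuc ℓ) where
  field
    State   : Set a
    inhabit : State
    rel     : Index n → Rel State ℓ
    isEquiv : ∀ τ → IsEquivalence (rel τ)
    V       : Prop → State → Set ℓ
open PreModel public

restrictRel : ∀ {n p a ℓ} {Prop : Set p} (M : PreModel n Prop a ℓ) →
              Group n → Index n → Rel (State M) ℓ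
restrictRel M G (agent i) with i ∈? members G
... | yes _ = rel M (grp G)
... | no  _ = rel M (agent i)
restrictRel M G (grp H) with nonempty? (members H ∩ members G)
... | yes _ = rel M (grp (H ∪ᴳ G))
... | no  _ = rel M (grp H)

restrictEquiv : ∀ {n p a ℓ} {Prop : Set p} (M : PreModel n Prop a ℓ) →
                (G : Group n) → ∀ τ → IsEquivalence (restrictRel M G τ)
restrictEquiv M G (agent i) with i ∈? members G
... | yes _ = isEquiv M (grp G)
... | no  _ = isEquiv M (agent i)
restrictEquiv M G (grp H) with nonempty? (members H ∩ members G)
... | yes _ = isEquiv M (grp (H ∪ᴳ G))
... | no  _ = isEquiv M (grp H)

_∣_ : ∀ {n p a ℓ} {Prop : Set p} → PreModel n Prop a ℓ → Group n →
      PreModel n Prop a ℓ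
M ∣ G = record
  { State = State M ; inhabit = inhabit M ; rel = restrictRel M G
  ; isEquiv = restrictEquiv M G ; V = V M }

-- Bisimulation between pre-models (nonemptiness of Z is implied in
-- 'Bisimilar' by the linked pair).
record IsBisimulation {n p a a' ℓ ℓ' z} {Prop : Set p}
       (M : PreModel n Prop a ℓ) (M' : PreModel n Prop a' ℓ')
       (Z : State M → State M' → Set z) : Set (p ⊔ a ⊔ a' ⊔ ℓ ⊔ ℓ' ⊔ z) where
  field
    atoms : ∀ {s s'} → Z s s' → ∀ q → (V M q s → V M' q s') × (V M' q s' → V M q s)
    forth : ∀ {s s'} → Z s s' → ∀ τ t → rel M τ s t →
            Σ (State M') λ t' → rel M' τ s' t' × Z t t'
    back  : ∀ {s s'} → Z s s' → ∀ τ t' → rel M' τ s' t' →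
            Σ (State M) λ t → rel M τ s t × Z t t'

Bisimilar : ∀ {n p a a' ℓ ℓ'} {Prop : Set p}
            (M : PreModel n Prop a ℓ) → State M →
            (M' : PreModel n Prop a' ℓ') → State M' →
            Set (p ⊔ lsuc (a ⊔ a' ⊔ ℓ ⊔ ℓ'))
Bisimilar {a = a} {a'} {ℓ} {ℓ'} M s M' s' =
  Σ (State M → State M' → Set (a ⊔ a' ⊔ ℓ ⊔ ℓ')) λ Z →
    IsBisimulation M M' Z × Z s s'

-- Each relation of M ∣ G is the relation of M at an index chosen by G alone,
-- uniformly in M, so any bisimulation between M and M' is one between M ∣ G and M' ∣ G.
module Submission where

open import Defs
open import Level using (Level)
open import Data.Nat using (ℕ)
open import Data.Product using (Σ; _×_; _,_)
open import Data.Fin.Subset using (_∩_)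
open import Data.Fin.Subset.Properties using (nonempty?; _∈?_)
open import Relation.Nullary using (yes; no)
open import Relation.Binary.PropositionalEquality using (_≡_; refl)

restrictIndex : ∀ {n} → Group n → Index n → Index n
restrictIndex G (agent i) with i ∈? members G
... | yes _ = grp G
... | no  _ = agent i
restrictIndex G (grp H) with nonempty? (members H ∩ members G)
... | yes _ = grp (H ∪ᴳ G)
... | no  _ = grp H

restrictRel≡rel∘restrictIndex : ∀ {n p a ℓ} {Prop : Set p}
  (M : PreModel n Prop a ℓ) (G : Group n) (τ : Index n) →
  restrictRel M G τ ≡ rel M (restrictIndex G τ)
restrictRel≡rel∘restrictIndex M G (agent i) with i ∈? members G
... | yes _ = refl
... | no  _ = refl
restrictRel≡rel∘restrictIndex M G (grp H) with nonempty? (members H ∩ members G)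
... | yes _ = refl
... | no  _ = refl

restrict-isBisimulation : ∀ {n p a a' ℓ ℓ' z} {Prop : Set p}
  {M : PreModel n Prop a ℓ} {M' : PreModel n Prop a' ℓ'}
  {Z : State M → State M' → Set z} (G : Group n) →
  IsBisimulation M M' Z → IsBisimulation (M ∣ G) (M' ∣ G) Z
restrict-isBisimulation {M = M} {M'} {Z} G B = record
  { atoms = atoms
  ; forth = forth′
  ; back  = back′
  }
  where
  open IsBisimulation B

  forth′ : ∀ {s s'} → Z s s' → ∀ τ t → restrictRel M G τ s t →
           Σ (State M') λ t' → restrictRel M' G τ s' t' × Z t t'
  forth′ sZs' τ t r
    rewrite restrictRel≡rel∘restrictIndex M G τ
          | restrictRel≡rel∘restrictIndex M' G τ
    = forth sZs' (restrictIndex G τ) t r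

  back′ : ∀ {s s'} → Z s s' → ∀ τ t' → restrictRel M' G τ s' t' →
          Σ (State M) λ t → restrictRel M G τ s t × Z t t'
  back′ sZs' τ t' r
    rewrite restrictRel≡rel∘restrictIndex M G τ
          | restrictRel≡rel∘restrictIndex M' G τ
    = back sZs' (restrictIndex G τ) t' r

proposition10 : ∀ {n : ℕ} {p a a' ℓ ℓ' : Level} {Prop : Set p}
                  (M : PreModel n Prop a ℓ) (s : State M)
                  (M' : PreModel n Prop a' ℓ') (s' : State M')
                  (G : Group n) →
                  Bisimilar M s M' s' →
                  Bisimilar (M ∣ G) s (M' ∣ G) s'
proposition10 M s M' s' G (Z , isBisim , sZs') =
  Z , restrict-isBisimulation G isBisim , sZs'
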